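{- Fix $2\le k<+\infty$. Suppose $aub\sim_k cvd$ with $a,b,c,d\in A$ letters and $u,v\in A^*$. Then $u\sim_{k-1}v$.
   Context: $|u|_x$ is the number of occurrences of the non-empty word $x$ as a factor of $u$; $u\sim_k v$ means $|u|_x=|v|_x$ for all non-empty $x$ with $|x|\le k$. -}

module Defs where

open import Data.Nat using (ℕ; zero; suc; _+_; _≤_)
open import Data.List using (List; []; _∷_; length)
open import Data.List.Relation.Binary.Prefix.Heterogeneous.Properties using (prefix?)
open import Data.List.Relation.Binary.Prefix.Heterogeneous using (Prefix)
open import Relation.Binary.PropositionalEquality using (_≡_)
open import Relation.Binary.Definitions using (DecidableEquality)
open import Relation.Nullary using (yes; no)

module _ {A : Set} (_≟_ : DecidableEquality A) where

  occ : List A → List A → ℕ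
  occ x [] = 0
  occ x w@(_ ∷ w′) with prefix? _≟_ x w
  ... | yes _ = suc (occ x w′)
  ... | no  _ = occ x w′

  -- u ∼_k v : |u|_x = |v|_x for all non-empty x with |x| ≤ k.
  -- (Note: for x ≠ [] no occurrence can start at the end position,
  --  so counting starting positions 0..|w|-1 is exact.)
  _∼[_]_ : List A → ℕ → List A → Set
  u ∼[ k ] v = ∀ (x : List A) → 1 ≤ length x → length x ≤ k → occ x u ≡ occ x v

-- Summing over a finite alphabet containing the letters of w, the occurrences of βx (resp. xβ)
-- in w count the occurrences of the non-empty word x in w without its first (resp. last)
-- letter.  Hence aub ∼ₖ cvd gives au ∼ₖ₋₁ cv and ub ∼ₖ₋₁ vd.  For |x| ≤ k − 1, comparing
-- |aub|_x = [x ≼ aub] + |ub|_x with its counterpart shows that x is a prefix of aub iff it is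
-- one of cvd; since also |au| = |cv|, the same holds for au and cv, and cancelling these
-- prefix indicators from |au|_x = |cv|_x leaves |u|_x = |v|_x.
module Submission where

open import Defs
open import Data.Nat using (ℕ; _≤_; _∸_)
open import Data.List using (List; _∷_; _++_; [_])
open import Relation.Binary.Definitions using (DecidableEquality)

open import Algebra.Properties.CommutativeSemigroup using (interchange)
open import Data.Nat using (suc; _+_; _*_; _<_; z≤n; s≤s; _≤?_)
open import Data.Nat.ListAction using (sum)
open import Data.Nat.Properties
  using (+-identityʳ; *-zeroʳ; *-distribˡ-+; +-cancelˡ-≡; +-cancelʳ-≡; +-comm;
         ≰⇒>; m≤n⇒m≤1+n; +-commutativeSemigroup)
open import Data.Bool using (if_then_else_)
open import Data.List using ([]; length; map; deduplicate)
open import Data.List.Properties using (length-++)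
open import Data.List.Membership.Propositional using (_∈_)
open import Data.List.Membership.Propositional.Properties
  using (∈-deduplicate⁺; ∈-++⁺ˡ; ∈-++⁺ʳ)
open import Data.List.Relation.Unary.All as All using (All; []; _∷_)
open import Data.List.Relation.Unary.AllPairs using (_∷_)
open import Data.List.Relation.Unary.Any using (here; there)
open import Data.List.Relation.Unary.Unique.Propositional using (Unique)
open import Data.List.Relation.Unary.Unique.DecPropositional.Properties using (deduplicate-!)
open import Data.List.Relation.Binary.Prefix.Heterogeneous.Properties using (prefix?)
open import Relation.Nullary using (Dec; yes; no; does; contradiction)
open import Relation.Binary.PropositionalEquality
  using (_≡_; _≢_; refl; sym; trans; cong; cong₂; subst; ≢-sym; module ≡-Reasoning)

indicator : {P : Set} → Dec P → ℕ
indicator d = if does d then 1 else 0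

∑ : {B : Set} → List B → (B → ℕ) → ℕ
∑ L f = sum (map f L)

syntax ∑ L (λ β → e) = ∑[ β ∈ L ] e

module _ {B : Set} where

  ∑-cong : ∀ (L : List B) {f g : B → ℕ} → (∀ β → f β ≡ g β) → ∑ L f ≡ ∑ L g
  ∑-cong []      f≗g = refl
  ∑-cong (β ∷ L) f≗g = cong₂ _+_ (f≗g β) (∑-cong L f≗g)

  ∑-zero : ∀ (L : List B) → ∑[ β ∈ L ] 0 ≡ 0
  ∑-zero []      = refl
  ∑-zero (_ ∷ L) = ∑-zero L

  ∑-distrib-+ : ∀ (L : List B) (f g : B → ℕ) → ∑[ β ∈ L ] (f β + g β) ≡ ∑ L f + ∑ L g
  ∑-distrib-+ []      f g = refl
  ∑-distrib-+ (β ∷ L) f g = trans (cong (f β + g β +_) (∑-distrib-+ L f g))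
                                  (interchange +-commutativeSemigroup (f β) (g β) (∑ L f) (∑ L g))

  ∑-*ˡ : ∀ (L : List B) (c : ℕ) (f : B → ℕ) → ∑[ β ∈ L ] (c * f β) ≡ c * ∑ L f
  ∑-*ˡ []      c f = sym (*-zeroʳ c)
  ∑-*ˡ (β ∷ L) c f = trans (cong (c * f β +_) (∑-*ˡ L c f)) (sym (*-distribˡ-+ c (f β) (∑ L f)))

module _ {A : Set} (_≟_ : DecidableEquality A) where

  ∣_∣_ : List A → List A → ℕ
  ∣ w ∣ x = occ _≟_ x w

  [_≼_] : List A → List A → ℕ
  [ x ≼ w ] = indicator (prefix? _≟_ x w)

  δ : A → A → ℕ
  δ β y = indicator (β ≟ y)

  δ-refl : ∀ y → δ y y ≡ 1
  δ-refl y with y ≟ y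
  ... | yes _   = refl
  ... | no  y≢y = contradiction refl y≢y

  δ-≢ : ∀ {β y} → β ≢ y → δ β y ≡ 0
  δ-≢ {β} {y} β≢y with β ≟ y
  ... | yes β≡y = contradiction β≡y β≢y
  ... | no  _   = refl

  ∑-δ-∉ : ∀ {L} y n → All (_≢ y) L → ∑[ β ∈ L ] (δ β y * n) ≡ 0
  ∑-δ-∉ y n []           = refl
  ∑-δ-∉ y n (β≢y ∷ β≢ys) rewrite δ-≢ β≢y = ∑-δ-∉ y n β≢ys

  ∑-δ : ∀ {L} → Unique L → ∀ {y} n → y ∈ L → ∑[ β ∈ L ] (δ β y * n) ≡ n
  ∑-δ {y ∷ L} (y≢L ∷ _) n (here refl)
    rewrite δ-refl y | ∑-δ-∉ y n (All.map ≢-sym y≢L) = trans (+-identityʳ _) (+-identityʳ n)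
  ∑-δ {β ∷ L} (β≢L ∷ L-unique) n (there y∈L)
    rewrite δ-≢ (All.lookup β≢L y∈L) = ∑-δ L-unique n y∈L

  ≼-∷ : ∀ p x y w → [ p ∷ x ≼ y ∷ w ] ≡ δ p y * [ x ≼ w ]
  ≼-∷ p x y w with p ≟ y
  ... | yes _ = sym (+-identityʳ _)
  ... | no  _ = refl

  occ-∷ : ∀ x y w → ∣ y ∷ w ∣ x ≡ [ x ≼ y ∷ w ] + ∣ w ∣ x
  occ-∷ x y w with prefix? _≟_ x (y ∷ w)
  ... | yes _ = refl
  ... | no  _ = refl

  ≼-++ : ∀ x s t → length x ≤ length s → [ x ≼ s ++ t ] ≡ [ x ≼ s ]
  ≼-++ []      s       t _         = refl
  ≼-++ (z ∷ x) (y ∷ s) t (s≤s x≤s) = begin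
    [ z ∷ x ≼ y ∷ s ++ t ]  ≡⟨ ≼-∷ z x y (s ++ t) ⟩
    δ z y * [ x ≼ s ++ t ]  ≡⟨ cong (δ z y *_) (≼-++ x s t x≤s) ⟩
    δ z y * [ x ≼ s ]       ≡⟨ ≼-∷ z x y s ⟨
    [ z ∷ x ≼ y ∷ s ]       ∎
    where open ≡-Reasoning

  ≼-short : ∀ x s → length s < length x → [ x ≼ s ] ≡ 0
  ≼-short (z ∷ x) []      _         = refl
  ≼-short (z ∷ x) (y ∷ s) (s≤s s<x) =
    trans (≼-∷ z x y s) (trans (cong (δ z y *_) (≼-short x s s<x)) (*-zeroʳ (δ z y)))

  ≼-∷ʳ-[] : ∀ x β → [ x ++ [ β ] ≼ [] ] ≡ 0
  ≼-∷ʳ-[] []      β = refl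
  ≼-∷ʳ-[] (_ ∷ _) β = refl

  ≼-init : ∀ x {s s′ t t′} → length s ≡ length t →
           [ x ≼ s ++ s′ ] ≡ [ x ≼ t ++ t′ ] → [ x ≼ s ] ≡ [ x ≼ t ]
  ≼-init x {s} {s′} {t} {t′} |s|≡|t| eq with length x ≤? length s
  ... | yes x≤s = begin
    [ x ≼ s ]       ≡⟨ ≼-++ x s s′ x≤s ⟨
    [ x ≼ s ++ s′ ] ≡⟨ eq ⟩
    [ x ≼ t ++ t′ ] ≡⟨ ≼-++ x t t′ (subst (length x ≤_) |s|≡|t| x≤s) ⟩
    [ x ≼ t ]       ∎
    where open ≡-Reasoning
  ... | no  x≰s = trans (≼-short x s (≰⇒> x≰s))
                        (sym (≼-short x t (subst (_< length x) |s|≡|t| (≰⇒> x≰s))))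

  ∑-occ-∷ : ∀ (L : List A) (f : A → List A) y w →
            ∑[ β ∈ L ] ∣ y ∷ w ∣ f β ≡ ∑[ β ∈ L ] [ f β ≼ y ∷ w ] + ∑[ β ∈ L ] ∣ w ∣ f β
  ∑-occ-∷ L f y w = trans (∑-cong L (λ β → occ-∷ (f β) y w)) (∑-distrib-+ L _ _)

  module Alphabet (L : List A) (L-unique : Unique L) where

    ∑-≼-∷ : ∀ x {y} w → y ∈ L → ∑[ β ∈ L ] [ β ∷ x ≼ y ∷ w ] ≡ [ x ≼ w ]
    ∑-≼-∷ x {y} w y∈L =
      trans (∑-cong L (λ β → ≼-∷ β x y w)) (∑-δ L-unique [ x ≼ w ] y∈L)

    occ-extendˡ : ∀ z x {y} w → All (_∈ L) (y ∷ w) →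
                  ∑[ β ∈ L ] ∣ y ∷ w ∣ (β ∷ z ∷ x) ≡ ∣ w ∣ (z ∷ x)
    occ-extendˡ z x {y} w (y∈L ∷ w⊆L) = begin
      ∑[ β ∈ L ] ∣ y ∷ w ∣ (β ∷ X)
        ≡⟨ ∑-occ-∷ L (_∷ X) y w ⟩
      ∑[ β ∈ L ] [ β ∷ X ≼ y ∷ w ] + ∑[ β ∈ L ] ∣ w ∣ (β ∷ X)
        ≡⟨ cong (_+ ∑[ β ∈ L ] ∣ w ∣ (β ∷ X)) (∑-≼-∷ X w y∈L) ⟩
      [ X ≼ w ] + ∑[ β ∈ L ] ∣ w ∣ (β ∷ X)
        ≡⟨ tail w w⊆L ⟩
      ∣ w ∣ X
        ∎
      where
      open ≡-Reasoning
      X = z ∷ x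
      tail : ∀ w → All (_∈ L) w → [ X ≼ w ] + ∑[ β ∈ L ] ∣ w ∣ (β ∷ X) ≡ ∣ w ∣ X
      tail []        []  = ∑-zero L
      tail (y′ ∷ w′) w⊆L = trans (cong ([ X ≼ y′ ∷ w′ ] +_) (occ-extendˡ z x w′ w⊆L))
                                 (sym (occ-∷ X y′ w′))

    ≼-extendʳ : ∀ x s {b} → All (_∈ L) (s ++ [ b ]) →
                ∑[ β ∈ L ] [ x ++ [ β ] ≼ s ++ [ b ] ] ≡ [ x ≼ s ]
    ≼-extendʳ []      []      {b} (b∈L ∷ _) = ∑-≼-∷ [] [] b∈L
    ≼-extendʳ []      (y ∷ s) {b} (y∈L ∷ _) = ∑-≼-∷ [] (s ++ [ b ]) y∈L
    ≼-extendʳ (z ∷ x) []      {b} _         = begin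
      ∑[ β ∈ L ] [ z ∷ x ++ [ β ] ≼ [ b ] ]     ≡⟨ ∑-cong L (λ β → ≼-∷ z (x ++ [ β ]) b []) ⟩
      ∑[ β ∈ L ] (δ z b * [ x ++ [ β ] ≼ [] ])  ≡⟨ ∑-*ˡ L (δ z b) _ ⟩
      δ z b * ∑[ β ∈ L ] [ x ++ [ β ] ≼ [] ]    ≡⟨ cong (δ z b *_) (∑-cong L (≼-∷ʳ-[] x)) ⟩
      δ z b * ∑[ β ∈ L ] 0                       ≡⟨ cong (δ z b *_) (∑-zero L) ⟩
      δ z b * 0                                  ≡⟨ *-zeroʳ (δ z b) ⟩
      0                                          ∎
      where open ≡-Reasoning
    ≼-extendʳ (z ∷ x) (y ∷ s) {b} (_ ∷ s⊆L) = begin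
      ∑[ β ∈ L ] [ z ∷ x ++ [ β ] ≼ y ∷ s ++ [ b ] ]
        ≡⟨ ∑-cong L (λ β → ≼-∷ z (x ++ [ β ]) y (s ++ [ b ])) ⟩
      ∑[ β ∈ L ] (δ z y * [ x ++ [ β ] ≼ s ++ [ b ] ])  ≡⟨ ∑-*ˡ L (δ z y) _ ⟩
      δ z y * ∑[ β ∈ L ] [ x ++ [ β ] ≼ s ++ [ b ] ]    ≡⟨ cong (δ z y *_) (≼-extendʳ x s s⊆L) ⟩
      δ z y * [ x ≼ s ]                                  ≡⟨ ≼-∷ z x y s ⟨
      [ z ∷ x ≼ y ∷ s ]                                  ∎
      where open ≡-Reasoning

    occ-extendʳ : ∀ z x s {b} → All (_∈ L) (s ++ [ b ]) →
                  ∑[ β ∈ L ] ∣ s ++ [ b ] ∣ (z ∷ x ++ [ β ]) ≡ ∣ s ∣ (z ∷ x)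
    occ-extendʳ z x []      {b} s⊆L@(_ ∷ _) =
      trans (∑-occ-∷ L (λ β → z ∷ x ++ [ β ]) b [])
            (cong₂ _+_ (≼-extendʳ (z ∷ x) [] s⊆L) (∑-zero L))
    occ-extendʳ z x (y ∷ s) {b} s⊆L@(_ ∷ s′⊆L) =
      trans (∑-occ-∷ L (λ β → z ∷ x ++ [ β ]) y (s ++ [ b ]))
            (trans (cong₂ _+_ (≼-extendʳ (z ∷ x) (y ∷ s) s⊆L) (occ-extendʳ z x s s′⊆L))
                   (sym (occ-∷ (z ∷ x) y s)))

    length≡∑occ : ∀ w → All (_∈ L) w → length w ≡ ∑[ β ∈ L ] ∣ w ∣ [ β ]
    length≡∑occ []      []          = sym (∑-zero L)
    length≡∑occ (y ∷ w) (y∈L ∷ w⊆L) =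
      sym (trans (∑-occ-∷ L [_] y w) (cong₂ _+_ (∑-≼-∷ [] w y∈L) (sym (length≡∑occ w w⊆L))))

  alphabet : List A → List A → List A
  alphabet s t = deduplicate _≟_ (s ++ t)

  alphabet-unique : ∀ s t → Unique (alphabet s t)
  alphabet-unique s t = deduplicate-! _≟_ (s ++ t)

  alphabet-⊇ˡ : ∀ s t → All (_∈ alphabet s t) s
  alphabet-⊇ˡ s t = All.tabulate (λ β∈s → ∈-deduplicate⁺ _≟_ (∈-++⁺ˡ β∈s))

  alphabet-⊇ʳ : ∀ s t → All (_∈ alphabet s t) t
  alphabet-⊇ʳ s t = All.tabulate (λ β∈t → ∈-deduplicate⁺ _≟_ (∈-++⁺ʳ s β∈t))

  ∼-dropʳ : ∀ {k} s t {b d} → _∼[_]_ _≟_ (s ++ [ b ]) (suc k) (t ++ [ d ]) → _∼[_]_ _≟_ s k t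
  ∼-dropʳ s t h []      ()
  ∼-dropʳ s t {b} {d} h (z ∷ x) _  |zx|≤k = begin
    ∣ s ∣ (z ∷ x)                            ≡⟨ occ-extendʳ z x s (alphabet-⊇ˡ s′ t′) ⟨
    ∑[ β ∈ L ] ∣ s′ ∣ (z ∷ x ++ [ β ])
      ≡⟨ ∑-cong L (λ β → h (z ∷ x ++ [ β ]) (s≤s z≤n) (s≤s (|x∷ʳβ|≤k β))) ⟩
    ∑[ β ∈ L ] ∣ t′ ∣ (z ∷ x ++ [ β ])       ≡⟨ occ-extendʳ z x t (alphabet-⊇ʳ s′ t′) ⟩
    ∣ t ∣ (z ∷ x)                            ∎
    where
    open ≡-Reasoning
    s′ = s ++ [ b ]
    t′ = t ++ [ d ]
    L  = alphabet s′ t′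
    open Alphabet L (alphabet-unique s′ t′)
    |x∷ʳβ|≤k : ∀ β → length (x ++ [ β ]) ≤ _
    |x∷ʳβ|≤k β = subst (_≤ _) (sym (trans (length-++ x) (+-comm (length x) 1))) |zx|≤k

  ∼-dropˡ : ∀ {k} y s y′ t → _∼[_]_ _≟_ (y ∷ s) (suc k) (y′ ∷ t) → _∼[_]_ _≟_ s k t
  ∼-dropˡ y s y′ t h []      ()
  ∼-dropˡ y s y′ t h (z ∷ x) _  |zx|≤k = begin
    ∣ s ∣ (z ∷ x)                     ≡⟨ occ-extendˡ z x s (alphabet-⊇ˡ (y ∷ s) (y′ ∷ t)) ⟨
    ∑[ β ∈ L ] ∣ y ∷ s ∣ (β ∷ z ∷ x)   ≡⟨ ∑-cong L (λ β → h (β ∷ z ∷ x) (s≤s z≤n) (s≤s |zx|≤k)) ⟩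
    ∑[ β ∈ L ] ∣ y′ ∷ t ∣ (β ∷ z ∷ x)  ≡⟨ occ-extendˡ z x t (alphabet-⊇ʳ (y ∷ s) (y′ ∷ t)) ⟩
    ∣ t ∣ (z ∷ x)                     ∎
    where
    open ≡-Reasoning
    L = alphabet (y ∷ s) (y′ ∷ t)
    open Alphabet L (alphabet-unique (y ∷ s) (y′ ∷ t))

  ∼-length : ∀ {k} s t → _∼[_]_ _≟_ s (suc k) t → length s ≡ length t
  ∼-length s t h = begin
    length s                    ≡⟨ length≡∑occ s (alphabet-⊇ˡ s t) ⟩
    ∑[ β ∈ L ] ∣ s ∣ [ β ]      ≡⟨ ∑-cong L (λ β → h [ β ] (s≤s z≤n) (s≤s z≤n)) ⟩
    ∑[ β ∈ L ] ∣ t ∣ [ β ]      ≡⟨ length≡∑occ t (alphabet-⊇ʳ s t) ⟨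
    length t                    ∎
    where
    open ≡-Reasoning
    L = alphabet s t
    open Alphabet L (alphabet-unique s t)

  ∼-≼ : ∀ {k y s y′ t} → _∼[_]_ _≟_ (y ∷ s) (suc k) (y′ ∷ t) →
        ∀ x → 1 ≤ length x → length x ≤ k → [ x ≼ y ∷ s ] ≡ [ x ≼ y′ ∷ t ]
  ∼-≼ {k} {y} {s} {y′} {t} h x 1≤|x| |x|≤k = +-cancelʳ-≡ (∣ s ∣ x) _ _ (begin
    [ x ≼ y ∷ s ] + ∣ s ∣ x     ≡⟨ occ-∷ x y s ⟨
    ∣ y ∷ s ∣ x                 ≡⟨ h x 1≤|x| (m≤n⇒m≤1+n |x|≤k) ⟩
    ∣ y′ ∷ t ∣ x                ≡⟨ occ-∷ x y′ t ⟩
    [ x ≼ y′ ∷ t ] + ∣ t ∣ x    ≡⟨ cong ([ x ≼ y′ ∷ t ] +_) (∼-dropˡ y s y′ t h x 1≤|x| |x|≤k) ⟨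
    [ x ≼ y′ ∷ t ] + ∣ s ∣ x    ∎)
    where open ≡-Reasoning

  ∼-tail : ∀ {k y s y′ t} → _∼[_]_ _≟_ (y ∷ s) k (y′ ∷ t) →
           (∀ x → 1 ≤ length x → length x ≤ k → [ x ≼ y ∷ s ] ≡ [ x ≼ y′ ∷ t ]) →
           _∼[_]_ _≟_ s k t
  ∼-tail {k} {y} {s} {y′} {t} h prefixes x 1≤|x| |x|≤k = +-cancelˡ-≡ [ x ≼ y ∷ s ] _ _ (begin
    [ x ≼ y ∷ s ] + ∣ s ∣ x     ≡⟨ occ-∷ x y s ⟨
    ∣ y ∷ s ∣ x                 ≡⟨ h x 1≤|x| |x|≤k ⟩
    ∣ y′ ∷ t ∣ x                ≡⟨ occ-∷ x y′ t ⟩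
    [ x ≼ y′ ∷ t ] + ∣ t ∣ x    ≡⟨ cong (_+ ∣ t ∣ x) (prefixes x 1≤|x| |x|≤k) ⟨
    [ x ≼ y ∷ s ] + ∣ t ∣ x     ∎)
    where open ≡-Reasoning

lemma5 : {A : Set} (_≟_ : DecidableEquality A) (k : ℕ) → 2 ≤ k →
    (a b c d : A) (u v : List A) →
    _∼[_]_ _≟_ (a ∷ (u ++ [ b ])) k (c ∷ (v ++ [ d ])) →
    _∼[_]_ _≟_ u (k ∸ 1) v
lemma5 _≟_ (suc (suc k)) (s≤s (s≤s z≤n)) a b c d u v h = ∼-tail _≟_ au∼cv same-prefixes
  where
  au∼cv : _∼[_]_ _≟_ (a ∷ u) (suc k) (c ∷ v)
  au∼cv = ∼-dropʳ _≟_ (a ∷ u) (c ∷ v) h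
  same-prefixes : ∀ x → 1 ≤ length x → length x ≤ suc k → [_≼_] _≟_ x (a ∷ u) ≡ [_≼_] _≟_ x (c ∷ v)
  same-prefixes x 1≤|x| |x|≤k =
    ≼-init _≟_ x (∼-length _≟_ (a ∷ u) (c ∷ v) au∼cv) (∼-≼ _≟_ h x 1≤|x| |x|≤k)
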